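{- If $(F_n)_{n\in\mathbb{N}}$ is a linear-like semiring family of graphs, then $\omega(F_n)=n$ for every $n\in\mathbb{N}$.
   Context: Graphs are undirected simple graphs, possibly infinite; $\omega$ is the clique number. The join $G+H$ is the disjoint union with all edges between the two parts added; the disjunctive product $G\ast H$ has vertex set $V(G)\times V(H)$ with $(v,w)\sim(v',w')$ iff $v\sim v'$ or $w\sim w'$. A semiring family is a sequence $(F_n)_{n\in\mathbb{N}}$ with $F_0=\emptyset$, $F_1\ne\emptyset$, and graph homomorphisms $F_n+F_m\to F_{n+m}$, $F_n\ast F_m\to F_{nm}$ for all $n,m$. For $S\subseteq V(G)$, $S^\perp$ is the set of vertices adjacent to all vertices of $S$; $S$ is a flat if $S^{\perp\perp}=S$; $\mathrm{rk}(S)=\omega(S^{\perp\perp})$. $(F_n)$ is linear-like if for every $n$ and every flat $S\subseteq V(F_n)$, the induced subgraph of $F_n$ on $S$ is homomorphically equivalent (homomorphisms both ways) to $F_{\mathrm{rk}(S)}$. -}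

module Defs where

open import Level using (Level; suc; _⊔_)
open import Data.Nat using (ℕ; _+_; _*_)
import Data.Nat as N
open import Data.Fin using (Fin)
open import Data.Product using (Σ; _×_; _,_; ∃-syntax)
open import Data.Sum using (_⊎_; inj₁; inj₂)
open import Data.Empty using (⊥)
open import Data.Unit.Polymorphic using (⊤)
open import Relation.Nullary using (¬_)
open import Relation.Binary.PropositionalEquality using (_≡_; _≢_)

record Graph (ℓ : Level) : Set (suc ℓ) where
  field
    V     : Set ℓ
    Adj   : V → V → Set ℓ
    sym   : ∀ {x y} → Adj x y → Adj y x
    irrefl : ∀ {x} → ¬ Adj x x
open Graph public

private variable ℓ : Level

Hom : Graph ℓ → Graph ℓ → Set ℓ
Hom G H = Σ (V G → V H) λ f → ∀ {x y} → Adj G x y → Adj H (f x) (f y)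

HomEquiv : Graph ℓ → Graph ℓ → Set ℓ
HomEquiv G H = Hom G H × Hom H G

joinAdj : (G H : Graph ℓ) → V G ⊎ V H → V G ⊎ V H → Set ℓ
joinAdj G H (inj₁ x) (inj₁ y) = Adj G x y
joinAdj G H (inj₁ x) (inj₂ y) = ⊤
joinAdj G H (inj₂ x) (inj₁ y) = ⊤
joinAdj G H (inj₂ x) (inj₂ y) = Adj H x y

join : Graph ℓ → Graph ℓ → Graph ℓ
join G H = record
  { V = V G ⊎ V H
  ; Adj = joinAdj G H
  ; sym = λ { {inj₁ x} {inj₁ y} a → sym G a
            ; {inj₁ x} {inj₂ y} a → _
            ; {inj₂ x} {inj₁ y} a → _
            ; {inj₂ x} {inj₂ y} a → sym H a }
  ; irrefl = λ { {inj₁ x} a → irrefl G a ; {inj₂ x} a → irrefl H a }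
  }

disj : Graph ℓ → Graph ℓ → Graph ℓ
disj G H = record
  { V = V G × V H
  ; Adj = λ { (v , w) (v' , w') → Adj G v v' ⊎ Adj H w w' }
  ; sym = λ { (inj₁ a) → inj₁ (sym G a) ; (inj₂ a) → inj₂ (sym H a) }
  ; irrefl = λ { (inj₁ a) → irrefl G a ; (inj₂ a) → irrefl H a }
  }

record SemiringFamily (F : ℕ → Graph ℓ) : Set ℓ where
  field
    empty₀    : ¬ V (F 0)
    nonempty₁ : V (F 1)
    joinHom   : ∀ n m → Hom (join (F n) (F m)) (F (n + m))
    prodHom   : ∀ n m → Hom (disj (F n) (F m)) (F (n * m))

Subset : Graph ℓ → Set (suc ℓ)
Subset {ℓ} G = V G → Set ℓ

perp : (G : Graph ℓ) → Subset G → Subset G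
perp G S v = ∀ u → S u → Adj G v u

IsFlat : (G : Graph ℓ) → Subset G → Set ℓ
IsFlat G S = ∀ v → (perp G (perp G S) v → S v) × (S v → perp G (perp G S) v)

induced : (G : Graph ℓ) → Subset G → Graph ℓ
induced G S = record
  { V = Σ (V G) S
  ; Adj = λ { (x , _) (y , _) → Adj G x y }
  ; sym = sym G
  ; irrefl = irrefl G
  }

HasClique : Graph ℓ → ℕ → Set ℓ
HasClique G k = Σ (Fin k → V G) λ f → ∀ i j → i ≢ j → Adj G (f i) (f j)

CliqueNumberIs : Graph ℓ → ℕ → Set ℓ
CliqueNumberIs G r = HasClique G r × ¬ HasClique G (N.suc r)

RankIs : (G : Graph ℓ) → Subset G → ℕ → Set ℓ
RankIs G S r = CliqueNumberIs (induced G (perp G (perp G S))) r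

LinearLike : (F : ℕ → Graph ℓ) → Set (suc ℓ)
LinearLike F = ∀ n (S : Subset (F n)) → IsFlat (F n) S →
  Σ ℕ λ r → RankIs (F n) S r × HomEquiv (induced (F n) S) (F r)

-- Joining copies of F₁ gives ω(Fₙ) ≥ n. The whole vertex set of Fₙ is a flat,
-- so Fₙ ≃ F_r with r = ω(Fₙ) ≥ n, whence ω(F_r) = r. Conversely, if ω(F_{m+1}) = m + 1,
-- the neighbourhood of a vertex of a maximum clique is a flat of clique number m,
-- hence homomorphically equivalent to F_m, and ω(F_m) = m. Descending from r reaches n.
module Submission where

open import Defs
open import Level using (Level)
open import Data.Nat using (ℕ; zero; suc; _+_; _∸_; _≤_; _≤?_)
open import Data.Nat.Properties using (≤-antisym; ≰⇒>; m∸n+n≡m)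
open import Data.Fin using (Fin; zero; suc; inject≤)
open import Data.Fin.Properties using (inject≤-injective; suc-injective)
open import Data.Product using (Σ; _×_; _,_; proj₁; proj₂)
open import Data.Sum using (inj₁; inj₂)
open import Data.Empty using (⊥-elim)
open import Data.Empty.Polymorphic using (⊥)
open import Data.Unit.Polymorphic using (tt)
open import Relation.Nullary using (¬_; yes; no)
open import Relation.Binary.PropositionalEquality using (_≡_; refl; subst; cong)
  renaming (sym to ≡-sym)

private variable
  ℓ : Level
  j k r s : ℕ

join-inj₂ : (G H : Graph ℓ) → Hom H (join G H)
join-inj₂ G H = inj₂ , λ a → a

induced-mono : (G : Graph ℓ) {S T : Subset G} → (∀ v → S v → T v) →
               Hom (induced G S) (induced G T)
induced-mono G S⊆T = (λ { (v , v∈S) → v , S⊆T v v∈S }) , λ a → a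

induced-proj : (G : Graph ℓ) (S : Subset G) → Hom (induced G S) G
induced-proj G S = proj₁ , λ a → a

HasClique-map : (G H : Graph ℓ) → Hom G H → HasClique G k → HasClique H k
HasClique-map G H (h , h-adj) (f , f-adj) =
  (λ i → h (f i)) , λ i j i≢j → h-adj (f-adj i j i≢j)

CliqueNumberIs-resp-HomEquiv : (G H : Graph ℓ) → HomEquiv G H →
                               CliqueNumberIs G r → CliqueNumberIs H r
CliqueNumberIs-resp-HomEquiv G H (g→h , h→g) (clique , noLarger) =
  HasClique-map G H g→h clique , λ c → noLarger (HasClique-map H G h→g c)

HasClique-≤ : (G : Graph ℓ) → j ≤ k → HasClique G k → HasClique G j
HasClique-≤ G j≤k (f , f-adj) =
  (λ i → f (inject≤ i j≤k)) ,
  λ i i' i≢i' → f-adj _ _ (λ eq → i≢i' (inject≤-injective j≤k j≤k i i' eq))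

HasClique⇒≤ : (G : Graph ℓ) → HasClique G j → ¬ HasClique G (suc k) → j ≤ k
HasClique⇒≤ {j = j} {k = k} G clique noLarger with j ≤? k
... | yes j≤k = j≤k
... | no j≰k  = ⊥-elim (noLarger (HasClique-≤ G (≰⇒> j≰k) clique))

CliqueNumberIs-unique : (G : Graph ℓ) → CliqueNumberIs G r → CliqueNumberIs G s → r ≡ s
CliqueNumberIs-unique G (cr , ¬cr+1) (cs , ¬cs+1) =
  ≤-antisym (HasClique⇒≤ G cr ¬cs+1) (HasClique⇒≤ G cs ¬cr+1)

HasClique-cons : (G : Graph ℓ) (v : V G) ((f , _) : HasClique G k) →
                 (∀ i → Adj G v (f i)) → HasClique G (suc k)
HasClique-cons {k = k} G v (f , f-adj) v-adj = cons , cons-adj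
  where
    cons : Fin (suc k) → V G
    cons zero    = v
    cons (suc i) = f i

    cons-adj : ∀ i j → ¬ i ≡ j → Adj G (cons i) (cons j)
    cons-adj zero    zero    i≢j = ⊥-elim (i≢j refl)
    cons-adj zero    (suc j) _   = v-adj j
    cons-adj (suc i) zero    _   = Graph.sym G (v-adj i)
    cons-adj (suc i) (suc j) i≢j = f-adj i j (λ eq → i≢j (cong suc eq))

perp-isFlat : (G : Graph ℓ) (T : Subset G) → IsFlat G (perp G T)
perp-isFlat G T v =
  (λ v∈T⊥⊥⊥ u u∈T → v∈T⊥⊥⊥ u (λ w w∈T⊥ → Graph.sym G (w∈T⊥ u u∈T))) ,
  (λ v∈T⊥ u u∈T⊥⊥ → Graph.sym G (u∈T⊥⊥ v v∈T⊥))

RankIs⇒CliqueNumberIs : (G : Graph ℓ) (S : Subset G) → IsFlat G S → RankIs G S r →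
                        CliqueNumberIs (induced G S) r
RankIs⇒CliqueNumberIs G S flat =
  CliqueNumberIs-resp-HomEquiv (induced G (perp G (perp G S))) (induced G S)
    (induced-mono G (λ v → proj₁ (flat v)) , induced-mono G (λ v → proj₂ (flat v)))

-- The whole vertex set, presented as ∅⊥ so that it is visibly a flat.
allVertices : (G : Graph ℓ) → Subset G
allVertices G = perp G (λ _ → ⊥)

allVertices-isFlat : (G : Graph ℓ) → IsFlat G (allVertices G)
allVertices-isFlat G = perp-isFlat G (λ _ → ⊥)

induced-allVertices : (G : Graph ℓ) → HomEquiv (induced G (allVertices G)) G
induced-allVertices G = induced-proj G (allVertices G) , ((λ v → v , λ _ ()) , λ a → a)

neighbourhood : (G : Graph ℓ) → V G → Subset G
neighbourhood G v = perp G (_≡ v)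

neighbourhood-cliqueNumber : (G : Graph ℓ) ((f , _) : HasClique G (suc k)) →
                             ¬ HasClique G (suc (suc k)) →
                             CliqueNumberIs (induced G (neighbourhood G (f zero))) k
neighbourhood-cliqueNumber {k = k} G (f , f-adj) noLarger = link , noLargerLink
  where
    N = induced G (neighbourhood G (f zero))

    link : HasClique N k
    link = (λ i → f (suc i) , λ { _ refl → f-adj (suc i) zero (λ ()) }) ,
           λ i j i≢j → f-adj (suc i) (suc j) (λ eq → i≢j (suc-injective eq))

    noLargerLink : ¬ HasClique N (suc k)
    noLargerLink c@(g , _) =
      noLarger (HasClique-cons G (f zero) (HasClique-map N G (induced-proj G _) c)
                               (λ i → Graph.sym G (proj₂ (g i) (f zero) refl)))

module _ (F : ℕ → Graph ℓ) (family : SemiringFamily F) (linearLike : LinearLike F) where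
  open SemiringFamily family

  F-hasClique : ∀ n → HasClique (F n) n
  F-hasClique zero    = (λ ()) , λ ()
  F-hasClique (suc n) =
    HasClique-map (join (F 1) (F n)) (F (suc n)) (joinHom 1 n)
      (HasClique-cons (join (F 1) (F n)) (inj₁ nonempty₁)
        (HasClique-map (F n) (join (F 1) (F n)) (join-inj₂ (F 1) (F n)) (F-hasClique n))
        (λ _ → tt))

  flat-cliqueNumber : ∀ n (S : Subset (F n)) → IsFlat (F n) S →
                      CliqueNumberIs (induced (F n) S) r → CliqueNumberIs (F r) r
  flat-cliqueNumber n S flat ωS with linearLike n S flat
  ... | r′ , rank , equiv =
    subst (λ k → CliqueNumberIs (F k) k) (CliqueNumberIs-unique (induced (F n) S) ωS′ ωS)
      (CliqueNumberIs-resp-HomEquiv (induced (F n) S) (F r′) equiv ωS′)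
    where ωS′ = RankIs⇒CliqueNumberIs (F n) S flat rank

  F-cliqueNumber : ∀ n → Σ ℕ λ r → CliqueNumberIs (F n) r × CliqueNumberIs (F r) r
  F-cliqueNumber n with linearLike n (allVertices (F n)) (allVertices-isFlat (F n))
  ... | r , rank , equiv =
    r , CliqueNumberIs-resp-HomEquiv All (F n) (induced-allVertices (F n)) ωAll
      , CliqueNumberIs-resp-HomEquiv All (F r) equiv ωAll
    where
      All = induced (F n) (allVertices (F n))
      ωAll = RankIs⇒CliqueNumberIs (F n) (allVertices (F n)) (allVertices-isFlat (F n)) rank

  cliqueNumber-pred : ∀ m → CliqueNumberIs (F (suc m)) (suc m) → CliqueNumberIs (F m) m
  cliqueNumber-pred m (clique , noLarger) =
    flat-cliqueNumber (suc m) (neighbourhood (F (suc m)) (proj₁ clique zero))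
      (perp-isFlat (F (suc m)) (_≡ proj₁ clique zero))
      (neighbourhood-cliqueNumber (F (suc m)) clique noLarger)

  cliqueNumber-descend : ∀ d m → CliqueNumberIs (F (d + m)) (d + m) → CliqueNumberIs (F m) m
  cliqueNumber-descend zero    m ω = ω
  cliqueNumber-descend (suc d) m ω = cliqueNumber-descend d m (cliqueNumber-pred (d + m) ω)

lemma4p7 : ∀ {ℓ : Level} (F : ℕ → Graph ℓ) → SemiringFamily F → LinearLike F →
    ∀ (n : ℕ) → CliqueNumberIs (F n) n
lemma4p7 F family linearLike n with F-cliqueNumber F family linearLike n
... | r , ωFn , ωFr = cliqueNumber-descend F family linearLike (r ∸ n) n ωFr′
  where
    n≤r : n ≤ r
    n≤r = HasClique⇒≤ (F n) (F-hasClique F family linearLike n) (proj₂ ωFn)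

    ωFr′ : CliqueNumberIs (F (r ∸ n + n)) (r ∸ n + n)
    ωFr′ = subst (λ k → CliqueNumberIs (F k) k) (≡-sym (m∸n+n≡m n≤r)) ωFr
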